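{- For all natural numbers $x,y$, $$S_{5,0}(32y)-S_{5,0}(32x)=5\bigl(S_{5,0}(2y)-S_{5,0}(2x)\bigr).$$
   Context: For an integer $n\ge 0$ with binary expansion $n=\sum_{k=0}^{v}a_k2^k$, $a_k\in\{0,1\}$, let $\sigma(n)=\sum_k a_k$ be its binary digit sum. For integers $m\ge 1$, $0\le l\le m-1$ and $x\in\mathbb{N}$, define $S_{m,l}(x)=\sum_{0\le n<x,\ n\equiv l \pmod m}(-1)^{\sigma(n)}$. The paper writes $S_{m,0}([a,b))=S_{m,0}(b)-S_{m,0}(a)$. -}

module Defs where

open import Data.Nat using (ℕ; zero; suc; _%_; _/_; _≟_)
import Data.Nat as ℕ
open import Data.Integer using (ℤ; +_; -_)
import Data.Integer as ℤ
open import Relation.Nullary using (yes; no)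

-- binary digit sum, computed with fuel (fuel n suffices since n/2 < n for n ≥ 1)
σAux : ℕ → ℕ → ℕ
σAux zero    n = 0
σAux (suc k) n = n % 2 ℕ.+ σAux k (n / 2)

σ : ℕ → ℕ
σ n = σAux n n

negOnePow : ℕ → ℤ
negOnePow zero    = + 1
negOnePow (suc k) = - negOnePow k

S : (m l : ℕ) .{{_ : ℕ.NonZero m}} → ℕ → ℤ
S m l zero    = + 0
S m l (suc x) with x % m ≟ l
... | yes _ = S m l x ℤ.+ negOnePow (σ x)
... | no  _ = S m l x

{-# OPTIONS --safe #-}
module Submission where

-- It suffices that S₅,₀(32k) = 5 S₅,₀(2k) for every k, by induction on k.  For r < 2^i the
-- binary expansion of 2^i k + r is that of k followed by that of r, so σ(2^i k + r) = σ k + σ r.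
-- As 32 ≡ 2 (mod 5), the numbers 32k + r (r < 32) and 2k + r (r < 2) have residue that of
-- 2(k mod 5) + r.  Hence both new blocks are (-1)^σ(k) times a sum depending only on k mod 5,
-- and the five resulting identities are checked by computation.

open import Defs
open import Data.Nat using (ℕ)
import Data.Nat as ℕ
open import Data.Integer using (ℤ; +_; _-_; _*_)
open import Relation.Binary.PropositionalEquality using (_≡_)

open import Data.Nat using (zero; suc; _%_; _/_; _^_; _≟_; _≤_; _<_; z≤n; s≤s; NonZero)
import Data.Nat.Properties as ℕₚ
open import Data.Nat.DivMod
open import Data.Nat.Solver using (module +-*-Solver)
open import Data.Integer using (-_; 0ℤ) renaming (_+_ to _⊕_)
import Data.Integer.Properties as ℤₚ
open import Data.Empty using (⊥-elim)
import Algebra.Properties.CommutativeSemigroup as CommutativeSemigroupProperties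
open import Relation.Nullary using (yes; no)
open import Relation.Binary.PropositionalEquality
  using (refl; sym; trans; cong; cong₂; module ≡-Reasoning)

σAux-zero : ∀ fuel → σAux fuel 0 ≡ 0
σAux-zero zero       = refl
σAux-zero (suc fuel) = σAux-zero fuel

n/2≤pred-n : ∀ n → n / 2 ≤ ℕ.pred n
n/2≤pred-n zero      = z≤n
n/2≤pred-n n@(suc _) = ℕₚ.≤-pred (m/n<m n 2 (s≤s (s≤s z≤n)))

σAux-fuel-irrelevant : ∀ f g n → n ≤ f → n ≤ g → σAux f n ≡ σAux g n
σAux-fuel-irrelevant zero    g       zero      _       _       = sym (σAux-zero g)
σAux-fuel-irrelevant (suc f) zero    zero      _       _       = σAux-zero (suc f)
σAux-fuel-irrelevant (suc f) (suc g) zero      _       _       =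
  σAux-fuel-irrelevant f g 0 z≤n z≤n
σAux-fuel-irrelevant (suc f) (suc g) n@(suc _) (s≤s n≤f) (s≤s n≤g) =
  cong (n % 2 ℕ.+_) (σAux-fuel-irrelevant f g (n / 2)
    (ℕₚ.≤-trans (n/2≤pred-n n) n≤f) (ℕₚ.≤-trans (n/2≤pred-n n) n≤g))

σ-unfold : ∀ n → σ n ≡ n % 2 ℕ.+ σ (n / 2)
σ-unfold zero    = refl
σ-unfold (suc n) = cong (suc n % 2 ℕ.+_)
  (σAux-fuel-irrelevant n (suc n / 2) (suc n / 2) (n/2≤pred-n (suc n)) ℕₚ.≤-refl)

σ-bit+2* : ∀ b m → b < 2 → σ (b ℕ.+ m ℕ.* 2) ≡ b ℕ.+ σ m
σ-bit+2* b m b<2 = trans (σ-unfold (b ℕ.+ m ℕ.* 2))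
  (cong₂ ℕ._+_ (trans ([m+kn]%n≡m%n b m 2) (m<n⇒m%n≡m b<2)) (cong σ (quotient b b<2)))
  where
  quotient : ∀ b → b < 2 → (b ℕ.+ m ℕ.* 2) / 2 ≡ m
  quotient 0 _ = m*n/n≡m m 2
  quotient 1 _ = trans (+-distrib-/ 1 (m ℕ.* 2) (s≤s (s≤s (ℕₚ.≤-reflexive ([m+kn]%n≡m%n 0 m 2)))))
                       (m*n/n≡m m 2)
  quotient (suc (suc _)) (s≤s (s≤s ()))

σ-2^i*k+r : ∀ i k r → r < 2 ^ i → σ (2 ^ i ℕ.* k ℕ.+ r) ≡ σ k ℕ.+ σ r
σ-2^i*k+r zero    k zero    _ =
  trans (cong σ (trans (ℕₚ.+-identityʳ _) (ℕₚ.*-identityˡ k))) (sym (ℕₚ.+-identityʳ (σ k)))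
σ-2^i*k+r zero    k (suc r) (s≤s ())
σ-2^i*k+r (suc i) k r r<2^[1+i] = begin
  σ (2 ^ suc i ℕ.* k ℕ.+ r)                 ≡⟨ cong (λ t → σ (2 ^ suc i ℕ.* k ℕ.+ t)) r≡b+q*2 ⟩
  σ (2 ^ suc i ℕ.* k ℕ.+ (b ℕ.+ q ℕ.* 2))   ≡⟨ cong σ (regroup (2 ^ i) k b q) ⟩
  σ (b ℕ.+ (2 ^ i ℕ.* k ℕ.+ q) ℕ.* 2)       ≡⟨ σ-bit+2* b (2 ^ i ℕ.* k ℕ.+ q) b<2 ⟩
  b ℕ.+ σ (2 ^ i ℕ.* k ℕ.+ q)               ≡⟨ cong (b ℕ.+_) (σ-2^i*k+r i k q q<2^i) ⟩
  b ℕ.+ (σ k ℕ.+ σ q)                       ≡⟨ x∙yz≈y∙xz b (σ k) (σ q) ⟩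
  σ k ℕ.+ (b ℕ.+ σ q)                       ≡⟨ cong (σ k ℕ.+_) (sym (σ-bit+2* b q b<2)) ⟩
  σ k ℕ.+ σ (b ℕ.+ q ℕ.* 2)                 ≡⟨ cong (λ t → σ k ℕ.+ σ t) (sym r≡b+q*2) ⟩
  σ k ℕ.+ σ r                               ∎
  where
  open ≡-Reasoning
  open +-*-Solver
  open CommutativeSemigroupProperties ℕₚ.+-commutativeSemigroup using (x∙yz≈y∙xz)
  b = r % 2
  q = r / 2
  b<2 : b < 2
  b<2 = m%n<n r 2
  q<2^i : q < 2 ^ i
  q<2^i = m<n*o⇒m/o<n (ℕₚ.≤-trans r<2^[1+i] (ℕₚ.≤-reflexive (ℕₚ.*-comm 2 (2 ^ i))))
  r≡b+q*2 : r ≡ b ℕ.+ q ℕ.* 2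
  r≡b+q*2 = m≡m%n+[m/n]*n r 2
  regroup : ∀ p k b q → 2 ℕ.* p ℕ.* k ℕ.+ (b ℕ.+ q ℕ.* 2) ≡ b ℕ.+ (p ℕ.* k ℕ.+ q) ℕ.* 2
  regroup = solve 4 (λ p k b q →
    con 2 :* p :* k :+ (b :+ q :* con 2) := b :+ (p :* k :+ q) :* con 2) refl

negOnePow-+ : ∀ a b → negOnePow (a ℕ.+ b) ≡ negOnePow a * negOnePow b
negOnePow-+ zero    b = sym (ℤₚ.*-identityˡ (negOnePow b))
negOnePow-+ (suc a) b = trans (cong -_ (negOnePow-+ a b))
  (ℤₚ.neg-distribˡ-* (negOnePow a) (negOnePow b))

sumBelow : ℕ → (ℕ → ℤ) → ℤ
sumBelow zero    f = 0ℤ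
sumBelow (suc n) f = sumBelow n f ⊕ f n

sumBelow-cong : ∀ n {f g : ℕ → ℤ} → (∀ r → r < n → f r ≡ g r) → sumBelow n f ≡ sumBelow n g
sumBelow-cong zero    f≗g = refl
sumBelow-cong (suc n) f≗g =
  cong₂ _⊕_ (sumBelow-cong n (λ r r<n → f≗g r (ℕₚ.m≤n⇒m≤1+n r<n))) (f≗g n ℕₚ.≤-refl)

sumBelow-*ˡ : ∀ n c (f : ℕ → ℤ) → sumBelow n (λ r → c * f r) ≡ c * sumBelow n f
sumBelow-*ˡ zero    c f = sym (ℤₚ.*-zeroʳ c)
sumBelow-*ˡ (suc n) c f = trans (cong (_⊕ c * f n) (sumBelow-*ˡ n c f))
  (sym (ℤₚ.*-distribˡ-+ c (sumBelow n f) (f n)))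

term : (m l : ℕ) .{{_ : NonZero m}} (c r : ℕ) → ℤ
term m l c r with (c ℕ.+ r) % m ≟ l
... | yes _ = negOnePow (σ r)
... | no  _ = 0ℤ

S-suc : ∀ m l .{{_ : NonZero m}} x → S m l (suc x) ≡ S m l x ⊕ term m l 0 x
S-suc m l x with x % m ≟ l
... | yes _ = refl
... | no  _ = sym (ℤₚ.+-identityʳ (S m l x))

S-+ : ∀ m l .{{_ : NonZero m}} a n → S m l (a ℕ.+ n) ≡ S m l a ⊕ sumBelow n (λ r → term m l 0 (a ℕ.+ r))
S-+ m l a zero    = trans (cong (S m l) (ℕₚ.+-identityʳ a)) (sym (ℤₚ.+-identityʳ (S m l a)))
S-+ m l a (suc n) = begin
  S m l (a ℕ.+ suc n)                           ≡⟨ cong (S m l) (ℕₚ.+-suc a n) ⟩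
  S m l (suc (a ℕ.+ n))                         ≡⟨ S-suc m l (a ℕ.+ n) ⟩
  S m l (a ℕ.+ n) ⊕ term m l 0 (a ℕ.+ n)         ≡⟨ cong (_⊕ term m l 0 (a ℕ.+ n)) (S-+ m l a n) ⟩
  S m l a ⊕ sumBelow n _ ⊕ term m l 0 (a ℕ.+ n)  ≡⟨ ℤₚ.+-assoc (S m l a) _ _ ⟩
  S m l a ⊕ sumBelow (suc n) _                  ∎
  where open ≡-Reasoning

term-factor : ∀ m l .{{_ : NonZero m}} {n k c r} →
  n % m ≡ (c ℕ.+ r) % m → σ n ≡ σ k ℕ.+ σ r →
  term m l 0 n ≡ negOnePow (σ k) * term m l c r
term-factor m l {n} {k} {c} {r} residue digits with n % m ≟ l | (c ℕ.+ r) % m ≟ l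
... | yes _  | yes _  = trans (cong negOnePow digits) (negOnePow-+ (σ k) (σ r))
... | yes n≡ | no c≢  = ⊥-elim (c≢ (trans (sym residue) n≡))
... | no n≢  | yes c≡ = ⊥-elim (n≢ (trans residue c≡))
... | no _   | no _   = sym (ℤₚ.*-zeroʳ (negOnePow (σ k)))

S-block : ∀ m l .{{_ : NonZero m}} i k c → (2 ^ i ℕ.* k) % m ≡ c % m →
  S m l (2 ^ i ℕ.* suc k) ≡ S m l (2 ^ i ℕ.* k) ⊕ negOnePow (σ k) * sumBelow (2 ^ i) (term m l c)
S-block m l i k c residue = begin
  S m l (2 ^ i ℕ.* suc k)                                          ≡⟨ cong (S m l) (trans (ℕₚ.*-suc (2 ^ i) k) (ℕₚ.+-comm (2 ^ i) _)) ⟩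
  S m l (2 ^ i ℕ.* k ℕ.+ 2 ^ i)                                    ≡⟨ S-+ m l (2 ^ i ℕ.* k) (2 ^ i) ⟩
  S m l (2 ^ i ℕ.* k) ⊕ sumBelow (2 ^ i) (λ r → term m l 0 (2 ^ i ℕ.* k ℕ.+ r))
                                                                   ≡⟨ cong (S m l (2 ^ i ℕ.* k) ⊕_) (sumBelow-cong (2 ^ i) factor) ⟩
  S m l (2 ^ i ℕ.* k) ⊕ sumBelow (2 ^ i) (λ r → negOnePow (σ k) * term m l c r)
                                                                   ≡⟨ cong (S m l (2 ^ i ℕ.* k) ⊕_) (sumBelow-*ˡ (2 ^ i) (negOnePow (σ k)) (term m l c)) ⟩
  S m l (2 ^ i ℕ.* k) ⊕ negOnePow (σ k) * sumBelow (2 ^ i) (term m l c) ∎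
  where
  open ≡-Reasoning
  factor : ∀ r → r < 2 ^ i → term m l 0 (2 ^ i ℕ.* k ℕ.+ r) ≡ negOnePow (σ k) * term m l c r
  factor r r<2^i = term-factor m l {2 ^ i ℕ.* k ℕ.+ r} {k}
    (begin
      (2 ^ i ℕ.* k ℕ.+ r) % m                ≡⟨ %-distribˡ-+ (2 ^ i ℕ.* k) r m ⟩
      ((2 ^ i ℕ.* k) % m ℕ.+ r % m) % m      ≡⟨ cong (λ t → (t ℕ.+ r % m) % m) residue ⟩
      (c % m ℕ.+ r % m) % m                  ≡⟨ %-distribˡ-+ c r m ⟨
      (c ℕ.+ r) % m                          ∎)
    (σ-2^i*k+r i k r r<2^i)

block-sums : ∀ j → j < 5 →
  sumBelow 32 (term 5 0 (2 ℕ.* j)) ≡ + 5 * sumBelow 2 (term 5 0 (2 ℕ.* j))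
block-sums 0 _ = refl
block-sums 1 _ = refl
block-sums 2 _ = refl
block-sums 3 _ = refl
block-sums 4 _ = refl
block-sums (suc (suc (suc (suc (suc _))))) (s≤s (s≤s (s≤s (s≤s (s≤s ())))))

S₅₀-32*≡5*S₅₀-2* : ∀ k → S 5 0 (32 ℕ.* k) ≡ + 5 * S 5 0 (2 ℕ.* k)
S₅₀-32*≡5*S₅₀-2* zero    = refl
S₅₀-32*≡5*S₅₀-2* (suc k) = begin
  S 5 0 (32 ℕ.* suc k)                             ≡⟨ S-block 5 0 5 k c (%-distribˡ-* 32 k 5) ⟩
  S 5 0 (32 ℕ.* k) ⊕ ε * sumBelow 32 t              ≡⟨ cong₂ _⊕_ (S₅₀-32*≡5*S₅₀-2* k)
                                                        (cong (ε *_) (block-sums (k % 5) (m%n<n k 5))) ⟩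
  + 5 * S 5 0 (2 ℕ.* k) ⊕ ε * (+ 5 * sumBelow 2 t)  ≡⟨ cong (+ 5 * S 5 0 (2 ℕ.* k) ⊕_) (x∙yz≈y∙xz ε (+ 5) _) ⟩
  + 5 * S 5 0 (2 ℕ.* k) ⊕ + 5 * (ε * sumBelow 2 t)  ≡⟨ ℤₚ.*-distribˡ-+ (+ 5) (S 5 0 (2 ℕ.* k)) (ε * sumBelow 2 t) ⟨
  + 5 * (S 5 0 (2 ℕ.* k) ⊕ ε * sumBelow 2 t)        ≡⟨ cong (+ 5 *_) (S-block 5 0 1 k c (%-distribˡ-* 2 k 5)) ⟨
  + 5 * S 5 0 (2 ℕ.* suc k)                        ∎
  where
  open ≡-Reasoning
  open CommutativeSemigroupProperties ℤₚ.*-commutativeSemigroup using (x∙yz≈y∙xz)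
  c = 2 ℕ.* (k % 5)
  ε = negOnePow (σ k)
  t = term 5 0 c

mainTheorem1 : (x y : ℕ) →
    S 5 0 (32 ℕ.* y) - S 5 0 (32 ℕ.* x) ≡ + 5 * (S 5 0 (2 ℕ.* y) - S 5 0 (2 ℕ.* x))
mainTheorem1 x y = begin
  S 5 0 (32 ℕ.* y) - S 5 0 (32 ℕ.* x)                 ≡⟨ cong₂ _-_ (S₅₀-32*≡5*S₅₀-2* y) (S₅₀-32*≡5*S₅₀-2* x) ⟩
  + 5 * S 5 0 (2 ℕ.* y) - + 5 * S 5 0 (2 ℕ.* x)       ≡⟨ cong (+ 5 * S 5 0 (2 ℕ.* y) ⊕_) (ℤₚ.neg-distribʳ-* (+ 5) _) ⟩
  + 5 * S 5 0 (2 ℕ.* y) ⊕ + 5 * - S 5 0 (2 ℕ.* x)     ≡⟨ ℤₚ.*-distribˡ-+ (+ 5) (S 5 0 (2 ℕ.* y)) (- S 5 0 (2 ℕ.* x)) ⟨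
  + 5 * (S 5 0 (2 ℕ.* y) - S 5 0 (2 ℕ.* x))           ∎
  where open ≡-Reasoning
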